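{- Let $T_q$ denote the set of integer triples $(a,b,c)\in\mathbb{Z}\times\mathbb{Z}\times\mathbb{N}$ with $a^2+qb^2=c^2$, and call $(a,b,c)$ primitive if $\gcd(a,b,c)=1$. (i) If $(a,b,c)\in T_2$ is primitive and $p$ is a prime divisor of $c$, then there exist $u,v\in\mathbb{Z}$ with $p=u^2+2v^2$. (ii) If $(a,b,c)\in T_3$ is primitive and $p$ is a prime divisor of $c$, then either $p=2$ or there exist $u,v\in\mathbb{Z}$ with $p=u^2+3v^2$. (iii) If $q\in\{5,6\}$, $(a,b,c)\in T_q$ is primitive and $p$ is a prime divisor of $c$, then there exist $u,v\in\mathbb{Z}$ with $p=u^2+qv^2$ or $2p=u^2+qv^2$.
   Context: $\mathbb{N}$ denotes the positive integers. -}

module Defs where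

open import Data.Nat as ℕ using (ℕ; suc)
open import Data.Nat.GCD using (gcd)
open import Data.Integer as ℤ using (ℤ; +_; ∣_∣)
open import Data.Product using (_×_; ∃)
open import Relation.Binary.PropositionalEquality using (_≡_)

-- T_q : triples (a , b , c) ∈ ℤ × ℤ × ℕ (ℕ = positive integers, so c ≥ 1)
-- with a² + q b² = c².
InT : ℕ → ℤ → ℤ → ℕ → Set
InT q a b c = (1 ℕ.≤ c) × (a ℤ.* a ℤ.+ (+ q) ℤ.* (b ℤ.* b) ≡ (+ c) ℤ.* (+ c))

Primitive : ℤ → ℤ → ℕ → Set
Primitive a b c = gcd (gcd ∣ a ∣ ∣ b ∣) c ≡ 1

RepBy : ℕ → ℤ → Set
RepBy q n = ∃ λ u → ∃ λ (v : ℤ) → n ≡ u ℤ.* u ℤ.+ (+ q) ℤ.* (v ℤ.* v)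

{-# OPTIONS --safe #-}
-- A prime p ∣ c cannot divide b (it would then divide a, b and c), so b is invertible modulo p
-- and -q ≡ r² (mod p): the form p x² + 2 r x y + w y² of determinant q represents p.
-- Lagrange reduction makes it a form a x² + 2 h x y + c y² with 2|h| ≤ a ≤ c, whence
-- 3a² ≤ 4q; for q ≤ 6 this leaves a ∈ {1, 2}, and then a p = (a x + h y)² + q y².
-- For q = 2 the case a = 2 is impossible, and for q = 3 it forces the form 2x² + 2hxy + 2y²,
-- which only represents even numbers, so p = 2.
module Submission where

open import Defs
open import Data.Nat using (ℕ; _*_)
open import Data.Nat.Divisibility using (_∣_)
open import Data.Nat.Primality using (Prime)
open import Data.Integer using (ℤ; +_)
open import Data.Product using (_×_)
open import Data.Sum using (_⊎_)
open import Relation.Binary.PropositionalEquality using (_≡_)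

import Data.Nat as ℕ
open import Data.Nat using (suc; _≤_; _<_; s≤s)
import Data.Nat.Properties as ℕ
open import Data.Nat.Divisibility using (divides; ∣m+n∣m⇒∣n; ∣m⇒∣m*n; ∣n⇒∣m*n; ∣1⇒≡1)
open import Data.Nat.Primality using (euclidsLemma; prime⇒irreducible; ¬prime[0]; ¬prime[1])
open import Data.Nat.Coprimality using (Coprime; coprime-Bézout)
import Data.Nat.Coprimality as Coprime
open import Data.Nat.GCD using (gcd-greatest; module Bézout)
open import Data.Nat.Induction using (<-rec)
open import Data.Integer using (+[1+_]; -[1+_]; _+_; _-_; -_; _⊖_; ∣_∣) renaming (_*_ to _·_)
import Data.Integer.Properties as ℤ
open import Data.Integer.DivMod using (_/ℕ_; _%ℕ_; a≡a%ℕn+[a/ℕn]*n; n%ℕd<d)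
open import Data.Integer.Tactic.RingSolver using (solve-∀)
import Data.Nat.Tactic.RingSolver as ℕ-Solver
open import Data.Product using (∃; ∃₂; _,_)
open import Data.Sum using (inj₁; inj₂)
import Data.Sum as Sum
open import Relation.Nullary using (¬_; yes; no; contradiction)
open import Relation.Nullary.Decidable using (from-yes; from-no)
open import Relation.Binary.PropositionalEquality
  using (refl; sym; trans; cong; cong₂; subst; module ≡-Reasoning)

i*i≡+∣i∣*∣i∣ : ∀ i → i · i ≡ + (∣ i ∣ ℕ.* ∣ i ∣)
i*i≡+∣i∣*∣i∣ (+ n)    = sym (ℤ.pos-* n n)
i*i≡+∣i∣*∣i∣ -[1+ n ] = refl

i+j-j≡i : ∀ i j → i + j - j ≡ i
i+j-j≡i = solve-∀

nearest-multiple : ∀ a .{{_ : ℕ.NonZero a}} h → ∃ λ k → 2 * ∣ h - k · + a ∣ ≤ a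
nearest-multiple a h = choose (h %ℕ a) (h /ℕ a) (a≡a%ℕn+[a/ℕn]*n h a) (n%ℕd<d h a)
  where
  choose : ∀ ρ d → h ≡ + ρ + d · + a → ρ < a → ∃ λ k → 2 * ∣ h - k · + a ∣ ≤ a
  choose ρ d h≡ρ+da ρ<a with 2 * ρ ℕ.≤? a
  ... | yes 2ρ≤a = d , subst (λ i → 2 * ∣ i ∣ ≤ a) (sym remainder) 2ρ≤a
    where
    remainder : h - d · + a ≡ + ρ
    remainder = trans (cong (_- d · + a) h≡ρ+da) (i+j-j≡i (+ ρ) (d · + a))
  ... | no 2ρ≰a = d + + 1 , subst (λ i → 2 * ∣ i ∣ ≤ a) (sym remainder) bound
    where
    remainder : h - (d + + 1) · + a ≡ - + (a ℕ.∸ ρ)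
    remainder = begin
      h - (d + + 1) · + a                 ≡⟨ cong (_- (d + + 1) · + a) h≡ρ+da ⟩
      (+ ρ + d · + a) - (d + + 1) · + a   ≡⟨ shift (+ ρ) d (+ a) ⟩
      + ρ - + a                           ≡⟨ ℤ.[+m]-[+n]≡m⊖n ρ a ⟩
      ρ ⊖ a                               ≡⟨ ℤ.⊖-≤ (ℕ.<⇒≤ ρ<a) ⟩
      - + (a ℕ.∸ ρ)                       ∎
      where
      open ≡-Reasoning
      shift : ∀ r d a → (r + d · a) - (d + + 1) · a ≡ r - a
      shift = solve-∀
    bound : 2 * ∣ - + (a ℕ.∸ ρ) ∣ ≤ a
    bound = begin
      2 * ∣ - + (a ℕ.∸ ρ) ∣   ≡⟨ cong (2 *_) (ℤ.∣-i∣≡∣i∣ (+ (a ℕ.∸ ρ))) ⟩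
      2 * (a ℕ.∸ ρ)           ≡⟨ ℕ.*-distribˡ-∸ 2 a ρ ⟩
      2 * a ℕ.∸ 2 * ρ         ≤⟨ ℕ.∸-monoʳ-≤ (2 * a) (ℕ.<⇒≤ (ℕ.≰⇒> 2ρ≰a)) ⟩
      2 * a ℕ.∸ a             ≡⟨ ℕ.m+n∸m≡n a (a ℕ.+ 0) ⟩
      a ℕ.+ 0                 ≡⟨ ℕ.+-identityʳ a ⟩
      a                       ∎
      where open ℕ.≤-Reasoning

prime∤⇒coprime : ∀ {p n} → Prime p → ¬ p ∣ n → Coprime p n
prime∤⇒coprime pp p∤n (d∣p , d∣n) with prime⇒irreducible pp d∣p
... | inj₁ d≡1 = d≡1
... | inj₂ refl = contradiction d∣n p∤n

coprime⇒bézout : ∀ {m n} → Coprime m n → ∃₂ λ s t → s · + m + t · + n ≡ + 1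
coprime⇒bézout {m} {n} coprime = fromIdentity (coprime-Bézout coprime)
  where
  lift : ∀ x m y n → 1 ℕ.+ y * n ≡ x * m → + 1 + + y · + n ≡ + x · + m
  lift x m y n eq = trans (cong (λ t → + 1 + t) (sym (ℤ.pos-* y n))) (trans (cong +_ eq) (ℤ.pos-* x m))

  cancelʳ : ∀ y n → (+ 1 + y · n) + - y · n ≡ + 1
  cancelʳ = solve-∀

  cancelˡ : ∀ x m → - x · m + (+ 1 + x · m) ≡ + 1
  cancelˡ = solve-∀

  fromIdentity : Bézout.Identity 1 m n → ∃₂ λ s t → s · + m + t · + n ≡ + 1
  fromIdentity (Bézout.+- x y 1+yn≡xm) =
    + x , - + y , trans (cong (_+ - + y · + n) (sym (lift x m y n 1+yn≡xm))) (cancelʳ (+ y) (+ n))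
  fromIdentity (Bézout.-+ x y 1+xm≡yn) =
    - + x , + y , trans (cong (λ t → - + x · + m + t) (sym (lift y n x m 1+xm≡yn))) (cancelˡ (+ x) (+ m))

-- If s inverts B modulo p, a² + q B² = c² and p ∣ c, then -q ≡ (a s)² modulo p.
minus-q-square-mod : ∀ q a B c k p s t →
                     a · a + q · (B · B) ≡ c · c → c ≡ k · p → s · B + t · p ≡ + 1 →
                     q + (a · s) · (a · s) ≡ p · (s · s · k · c + q · t · (+ 2 · s · B + t · p))
minus-q-square-mod q a B c k p s t a²+qB²≡c² c≡kp sB+tp≡1 = begin
  q + (a · s) · (a · s)
    ≡⟨ unit q (a · s) ⟩
  q · (+ 1 · + 1) + (a · s) · (a · s)
    ≡⟨ cong (λ x → q · (x · x) + (a · s) · (a · s)) sB+tp≡1 ⟨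
  q · ((s · B + t · p) · (s · B + t · p)) + (a · s) · (a · s)
    ≡⟨ expand q a B p s t ⟩
  s · s · (a · a + q · (B · B)) + p · X
    ≡⟨ cong (λ x → s · s · x + p · X) a²+qB²≡c² ⟩
  s · s · (c · c) + p · X
    ≡⟨ cong (λ x → s · s · (x · c) + p · X) c≡kp ⟩
  s · s · (k · p · c) + p · X
    ≡⟨ factor s k p c X ⟩
  p · (s · s · k · c + X) ∎
  where
  open ≡-Reasoning
  X = q · t · (+ 2 · s · B + t · p)
  unit : ∀ q r → q + r · r ≡ q · (+ 1 · + 1) + r · r
  unit = solve-∀
  expand : ∀ q a B p s t → q · ((s · B + t · p) · (s · B + t · p)) + (a · s) · (a · s)
                           ≡ s · s · (a · a + q · (B · B)) + p · (q · t · (+ 2 · s · B + t · p))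
  expand = solve-∀
  factor : ∀ s k p c X → s · s · (k · p · c) + p · X ≡ p · (s · s · k · c + X)
  factor = solve-∀

record Form : Set where
  constructor form
  field
    a h c : ℤ

value : Form → ℤ → ℤ → ℤ
value (form a h c) x y = a · x · x + + 2 · h · x · y + c · y · y

det : Form → ℤ
det (form a h c) = a · c - h · h

infix 4 _represents_
_represents_ : Form → ℤ → Set
f represents n = ∃₂ λ x y → value f x y ≡ n

translate : ℤ → Form → Form
translate k (form a h c) = form a (h - k · a) (c - + 2 · k · h + k · k · a)

swap : Form → Form
swap (form a h c) = form c (- h) a

det-translate : ∀ k f → det (translate k f) ≡ det f
det-translate k (form a h c) = expand a h c k
  where
  expand : ∀ a h c k → a · (c - + 2 · k · h + k · k · a) - (h - k · a) · (h - k · a) ≡ a · c - h · h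
  expand = solve-∀

det-swap : ∀ f → det (swap f) ≡ det f
det-swap (form a h c) = expand a h c
  where
  expand : ∀ a h c → c · a - (- h) · (- h) ≡ a · c - h · h
  expand = solve-∀

translate-represents : ∀ k {f n} → f represents n → translate k f represents n
translate-represents k {form a h c} (x , y , refl) = x + k · y , y , expand a h c k x y
  where
  expand : ∀ a h c k x y →
           a · (x + k · y) · (x + k · y) + + 2 · (h - k · a) · (x + k · y) · y
             + (c - + 2 · k · h + k · k · a) · y · y
           ≡ a · x · x + + 2 · h · x · y + c · y · y
  expand = solve-∀

swap-represents : ∀ {f n} → f represents n → swap f represents n
swap-represents {form a h c} (x , y , refl) = - y , x , expand a h c x y
  where
  expand : ∀ a h c x y →
           c · (- y) · (- y) + + 2 · (- h) · (- y) · x + a · x · x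
           ≡ a · x · x + + 2 · h · x · y + c · y · y
  expand = solve-∀

represents-leading : ∀ f → f represents Form.a f
represents-leading (form a h c) = + 1 , + 0 , expand a h c
  where
  expand : ∀ a h c → a · + 1 · + 1 + + 2 · h · + 1 · + 0 + c · + 0 · + 0 ≡ a
  expand = solve-∀

represents⇒RepBy-leading* : ∀ {q f n} → det f ≡ + q → f represents n → RepBy q (Form.a f · n)
represents⇒RepBy-leading* {q} {form a h c} det≡q (x , y , refl) =
  a · x + h · y , y ,
  trans (complete a h c x y) (cong (λ d → (a · x + h · y) · (a · x + h · y) + d · (y · y)) det≡q)
  where
  complete : ∀ a h c x y →
             a · (a · x · x + + 2 · h · x · y + c · y · y)
             ≡ (a · x + h · y) · (a · x + h · y) + (a · c - h · h) · (y · y)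
  complete = solve-∀

q+h*h≡a*c⇒det≡q : ∀ a h c {q} → q + h · h ≡ a · c → det (form a h c) ≡ q
q+h*h≡a*c⇒det≡q a h c {q} q+h²≡ac = trans (cong (_- h · h) (sym q+h²≡ac)) (i+j-j≡i q (h · h))

det≡q⇒a*c≡q+h*h : ∀ a h c {q} → det (form a h c) ≡ q → a · c ≡ q + h · h
det≡q⇒a*c≡q+h*h a h c det≡q = trans (expand a h c) (cong (_+ h · h) det≡q)
  where
  expand : ∀ a h c → a · c ≡ (a · c - h · h) + h · h
  expand = solve-∀

det≡q⇒a*c≡q+∣h∣*∣h∣ : ∀ a h c {q} → det (form (+ a) h (+ c)) ≡ + q → a * c ≡ q ℕ.+ ∣ h ∣ * ∣ h ∣
det≡q⇒a*c≡q+∣h∣*∣h∣ a h c {q} det≡q =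
  ℤ.+-injective (trans (ℤ.pos-* a c)
    (trans (det≡q⇒a*c≡q+h*h (+ a) h (+ c) det≡q) (cong (λ s → + q + s) (i*i≡+∣i∣*∣i∣ h))))

positive-definite⇒c>0 : ∀ {a q} h c → det (form +[1+ a ] h c) ≡ +[1+ q ] → ∃ λ m → c ≡ +[1+ m ]
positive-definite⇒c>0 {a} {q} h c det≡q =
  last-positive c
    (trans (det≡q⇒a*c≡q+h*h +[1+ a ] h c det≡q) (cong (λ s → +[1+ q ] + s) (i*i≡+∣i∣*∣i∣ h)))
  where
  last-positive : ∀ c → +[1+ a ] · c ≡ +[1+ q ℕ.+ ∣ h ∣ ℕ.* ∣ h ∣ ] → ∃ λ m → c ≡ +[1+ m ]
  last-positive +[1+ m ] _ = m , refl
  last-positive (+ 0)    e with () ← trans (sym (ℤ.*-zeroʳ +[1+ a ])) e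
  last-positive -[1+ m ] ()

record ReducedForm (q : ℕ) (n : ℤ) : Set where
  constructor reduced
  field
    a c : ℕ
    h : ℤ
    a≤c : a ≤ c
    2∣h∣≤a : 2 * ∣ h ∣ ≤ a
    det≡q : det (form (+ a) h (+ c)) ≡ + q
    represents : form (+ a) h (+ c) represents n

-- Each round translates until 2|h| ≤ a, then swaps a and c unless already a ≤ c; a swap strictly decreases a.
reduce : ∀ {q n} a h c → det (form +[1+ a ] h c) ≡ +[1+ q ] → form +[1+ a ] h c represents n →
         ReducedForm (suc q) n
reduce {q} {n} = <-rec P step
  where
  P : ℕ → Set
  P a = ∀ h c → det (form +[1+ a ] h c) ≡ +[1+ q ] → form +[1+ a ] h c represents n →
        ReducedForm (suc q) n

  step : ∀ a → (∀ {b} → b < a → P b) → P a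
  step a smaller h c det≡q rep with nearest-multiple (suc a) h
  ... | k , 2∣h'∣≤a = swap-or-stop (Form.h f') (Form.c f') 2∣h'∣≤a
                        (trans (det-translate k f) det≡q) (translate-represents k {f} rep)
    where
    f = form +[1+ a ] h c
    f' = translate k f

    swap-or-stop : ∀ h' c' → 2 * ∣ h' ∣ ≤ suc a → det (form +[1+ a ] h' c') ≡ +[1+ q ] →
                   form +[1+ a ] h' c' represents n → ReducedForm (suc q) n
    swap-or-stop h' c' small det'≡q rep' with positive-definite⇒c>0 {a} h' c' det'≡q
    ... | m , refl with suc m ℕ.<? suc a
    ...   | yes m<a = smaller (ℕ.≤-pred m<a) (- h') +[1+ a ]
                        (trans (det-swap (form +[1+ a ] h' +[1+ m ])) det'≡q)
                        (swap-represents {form +[1+ a ] h' +[1+ m ]} rep')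
    ...   | no  m≮a = reduced (suc a) (suc m) h' (ℕ.≮⇒≥ m≮a) small det'≡q rep'

reduced⇒3*a*a≤4*q : ∀ {q a c s} → a ≤ c → 2 * s ≤ a → a * c ≡ q ℕ.+ s * s → 3 * (a * a) ≤ 4 * q
reduced⇒3*a*a≤4*q {q} {a} {c} {s} a≤c 2s≤a ac≡q+s² = ℕ.+-cancelʳ-≤ (a * a) (3 * (a * a)) (4 * q) (begin
  3 * (a * a) ℕ.+ a * a        ≡⟨ split a ⟩
  4 * (a * a)                  ≤⟨ ℕ.*-monoʳ-≤ 4 (ℕ.*-monoʳ-≤ a a≤c) ⟩
  4 * (a * c)                  ≡⟨ cong (4 *_) ac≡q+s² ⟩
  4 * (q ℕ.+ s * s)            ≡⟨ distribute q s ⟩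
  4 * q ℕ.+ 2 * s * (2 * s)    ≤⟨ ℕ.+-monoʳ-≤ (4 * q) (ℕ.*-mono-≤ 2s≤a 2s≤a) ⟩
  4 * q ℕ.+ a * a              ∎)
  where
  open ℕ.≤-Reasoning
  split : ∀ a → 3 * (a * a) ℕ.+ a * a ≡ 4 * (a * a)
  split = ℕ-Solver.solve-∀
  distribute : ∀ q s → 4 * (q ℕ.+ s * s) ≡ 4 * q ℕ.+ 2 * s * (2 * s)
  distribute = ℕ-Solver.solve-∀

leading≤2 : ∀ {q a} → 3 * (a * a) ≤ 4 * q → q ≤ 6 → a ≤ 2
leading≤2 {q} {a} bound q≤6 with a ℕ.≤? 2
... | yes a≤2 = a≤2
... | no  a≰2 =
  contradiction (ℕ.≤-trans 27≤3a² (ℕ.≤-trans bound (ℕ.*-monoʳ-≤ 4 q≤6))) (from-no (27 ℕ.≤? 24))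
  where
  27≤3a² : 27 ≤ 3 * (a * a)
  27≤3a² = ℕ.*-monoʳ-≤ 3 (ℕ.*-mono-≤ (ℕ.≰⇒> a≰2) (ℕ.≰⇒> a≰2))

leading≡1⊎2 : ∀ {q a c s} → a ≤ 2 → a * c ≡ suc q ℕ.+ s * s → a ≡ 1 ⊎ a ≡ 2
leading≡1⊎2 {a = 0} _ ()
leading≡1⊎2 {a = 1} _ _ = inj₁ refl
leading≡1⊎2 {a = 2} _ _ = inj₂ refl
leading≡1⊎2 {a = suc (suc (suc _))} (s≤s (s≤s ())) _

reduced-leading≡1⊎2 : ∀ {q n} → suc q ≤ 6 → (R : ReducedForm (suc q) n) →
                      ReducedForm.a R ≡ 1 ⊎ ReducedForm.a R ≡ 2
reduced-leading≡1⊎2 q≤6 (reduced a c h a≤c 2∣h∣≤a det≡q _) =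
  leading≡1⊎2 {c = c} {s = ∣ h ∣}
    (leading≤2 (reduced⇒3*a*a≤4*q {s = ∣ h ∣} a≤c 2∣h∣≤a ac≡q+h²) q≤6) ac≡q+h²
  where
  ac≡q+h² : a * c ≡ _ ℕ.+ ∣ h ∣ * ∣ h ∣
  ac≡q+h² = det≡q⇒a*c≡q+∣h∣*∣h∣ a h c det≡q

reduced⇒RepBy : ∀ {q n} (R : ReducedForm q n) → RepBy q (+ ReducedForm.a R · n)
reduced⇒RepBy (reduced a c h _ _ det≡q rep) =
  represents⇒RepBy-leading* {f = form (+ a) h (+ c)} det≡q rep

reduced-leading≡2⇒2*c≤1+q : ∀ {q n} (R : ReducedForm q n) → ReducedForm.a R ≡ 2 → 2 * ReducedForm.c R ≤ suc q
reduced-leading≡2⇒2*c≤1+q {q} (reduced .2 c h _ 2∣h∣≤2 det≡q _) refl = begin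
  2 * c                    ≡⟨ det≡q⇒a*c≡q+∣h∣*∣h∣ 2 h c det≡q ⟩
  q ℕ.+ ∣ h ∣ * ∣ h ∣      ≤⟨ ℕ.+-monoʳ-≤ q (ℕ.*-mono-≤ ∣h∣≤1 ∣h∣≤1) ⟩
  q ℕ.+ 1                  ≡⟨ ℕ.+-comm q 1 ⟩
  suc q                    ∎
  where
  open ℕ.≤-Reasoning
  ∣h∣≤1 : ∣ h ∣ ≤ 1
  ∣h∣≤1 = ℕ.*-cancelˡ-≤ 2 2∣h∣≤2

even-form-represents-prime⇒≡2 : ∀ {h p} → Prime p → form (+ 2) h (+ 2) represents + p → p ≡ 2
even-form-represents-prime⇒≡2 {h} {p} pp (x , y , value≡p) =
  Sum.[ (λ ()) , sym ]′ (prime⇒irreducible pp 2∣p)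
  where
  w = x · x + h · x · y + y · y
  halve : ∀ h x y → + 2 · x · x + + 2 · h · x · y + + 2 · y · y ≡ + 2 · (x · x + h · x · y + y · y)
  halve = solve-∀
  2∣p : 2 ∣ p
  2∣p = divides ∣ w ∣ (trans (cong ∣_∣ (trans (sym value≡p) (halve h x y)))
                              (trans (ℤ.abs-* (+ 2) w) (ℕ.*-comm 2 ∣ w ∣)))

reduced-det2⇒RepBy : ∀ {n} → ReducedForm 2 n → RepBy 2 n
reduced-det2⇒RepBy {n} R@(reduced a c _ a≤c _ _ _) with reduced-leading≡1⊎2 (from-yes (2 ℕ.≤? 6)) R
... | inj₁ refl = subst (RepBy 2) (ℤ.*-identityˡ n) (reduced⇒RepBy R)
... | inj₂ refl = contradiction (ℕ.≤-trans (ℕ.*-monoʳ-≤ 2 a≤c) (reduced-leading≡2⇒2*c≤1+q R refl))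
                                (from-no (4 ℕ.≤? 3))

reduced-det3⇒RepBy : ∀ {p} → Prime p → ReducedForm 3 (+ p) → p ≡ 2 ⊎ RepBy 3 (+ p)
reduced-det3⇒RepBy {p} pp R@(reduced a c h a≤c _ _ rep) with reduced-leading≡1⊎2 (from-yes (3 ℕ.≤? 6)) R
... | inj₁ refl = inj₂ (subst (RepBy 3) (ℤ.*-identityˡ (+ p)) (reduced⇒RepBy R))
... | inj₂ refl =
  inj₁ (even-form-represents-prime⇒≡2 {h} pp (subst (λ c → form (+ 2) h (+ c) represents + p) c≡2 rep))
  where
  c≡2 : c ≡ 2
  c≡2 = ℕ.≤-antisym (ℕ.*-cancelˡ-≤ 2 (reduced-leading≡2⇒2*c≤1+q R refl)) a≤c

reduced-det≤6⇒RepBy : ∀ {q n} → suc q ≤ 6 → ReducedForm (suc q) n →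
                      RepBy (suc q) n ⊎ RepBy (suc q) (+ 2 · n)
reduced-det≤6⇒RepBy {q} {n} q≤6 R@(reduced a _ _ _ _ _ _) with reduced-leading≡1⊎2 q≤6 R
... | inj₁ refl = inj₁ (subst (RepBy (suc q)) (ℤ.*-identityˡ n) (reduced⇒RepBy R))
... | inj₂ refl = inj₂ (reduced⇒RepBy R)

InT⇒abs-equation : ∀ q a b c → InT q a b c → ∣ a ∣ * ∣ a ∣ ℕ.+ q * (∣ b ∣ * ∣ b ∣) ≡ c * c
InT⇒abs-equation q a b c (_ , a²+qb²≡c²) = ℤ.+-injective (begin
  + (∣ a ∣ * ∣ a ∣) + + (q * (∣ b ∣ * ∣ b ∣))
    ≡⟨ cong₂ _+_ (sym (i*i≡+∣i∣*∣i∣ a))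
                 (trans (ℤ.pos-* q _) (cong (+ q ·_) (sym (i*i≡+∣i∣*∣i∣ b)))) ⟩
  a · a + + q · (b · b)  ≡⟨ a²+qb²≡c² ⟩
  + c · + c              ≡⟨ ℤ.pos-* c c ⟨
  + (c * c)              ∎)
  where open ≡-Reasoning

prime-divisor∤b : ∀ q a b c {p} → InT q a b c → Primitive a b c → Prime p → p ∣ c → ¬ p ∣ ∣ b ∣
prime-divisor∤b q a b c {p} T prim pp p∣c p∣b = ¬prime[1] (subst Prime (∣1⇒≡1 p∣1) pp)
  where
  p∣qb²+a² : p ∣ q * (∣ b ∣ * ∣ b ∣) ℕ.+ ∣ a ∣ * ∣ a ∣
  p∣qb²+a² = subst (p ∣_) (trans (sym (InT⇒abs-equation q a b c T)) (ℕ.+-comm (∣ a ∣ * ∣ a ∣) _))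
                     (∣m⇒∣m*n c p∣c)
  p∣a : p ∣ ∣ a ∣
  p∣a = Sum.reduce
          (euclidsLemma ∣ a ∣ ∣ a ∣ pp (∣m+n∣m⇒∣n p∣qb²+a² (∣n⇒∣m*n q (∣m⇒∣m*n ∣ b ∣ p∣b))))
  p∣1 : p ∣ 1
  p∣1 = subst (p ∣_) prim (gcd-greatest (gcd-greatest p∣a p∣b) p∣c)

prime-divisor⇒form : ∀ q a b c {p} → InT q a b c → Primitive a b c → Prime p → p ∣ c →
                     ∃₂ λ r w → det (form (+ p) r w) ≡ + q
prime-divisor⇒form q a b c {p} T@(_ , a²+qb²≡c²) prim pp p∣c@(divides k c≡kp)
  with coprime⇒bézout (Coprime.sym (prime∤⇒coprime pp (prime-divisor∤b q a b c T prim pp p∣c)))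
... | s , t , sB+tp≡1 = a · s , _ , q+h*h≡a*c⇒det≡q (+ p) (a · s) _
        (minus-q-square-mod (+ q) a (+ ∣ b ∣) (+ c) (+ k) (+ p) s t a²+qB²≡c² c≡kp′ sB+tp≡1)
  where
  B²≡b² : + ∣ b ∣ · + ∣ b ∣ ≡ b · b
  B²≡b² = trans (sym (ℤ.pos-* ∣ b ∣ ∣ b ∣)) (sym (i*i≡+∣i∣*∣i∣ b))
  a²+qB²≡c² : a · a + + q · (+ ∣ b ∣ · + ∣ b ∣) ≡ + c · + c
  a²+qB²≡c² = trans (cong (λ x → a · a + + q · x) B²≡b²) a²+qb²≡c²
  c≡kp′ : + c ≡ + k · + p
  c≡kp′ = trans (cong +_ c≡kp) (ℤ.pos-* k p)

prime-divisor⇒reducedForm : ∀ q a b c {p} → InT (suc q) a b c → Primitive a b c → Prime p → p ∣ c →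
                            ReducedForm (suc q) (+ p)
prime-divisor⇒reducedForm q a b c {0} _ _ pp _ = contradiction pp ¬prime[0]
prime-divisor⇒reducedForm q a b c {suc p} T prim pp p∣c =
  let r , w , det≡q = prime-divisor⇒form (suc q) a b c T prim pp p∣c
  in reduce p r w det≡q (represents-leading (form (+ suc p) r w))

lemma2 : ((a b : ℤ) (c p : ℕ) → InT 2 a b c → Primitive a b c → Prime p → p ∣ c →
              RepBy 2 (+ p))
         × ((a b : ℤ) (c p : ℕ) → InT 3 a b c → Primitive a b c → Prime p → p ∣ c →
              p ≡ 2 ⊎ RepBy 3 (+ p))
         × ((q : ℕ) → q ≡ 5 ⊎ q ≡ 6 → (a b : ℤ) (c p : ℕ) → InT q a b c → Primitive a b c →
              Prime p → p ∣ c → RepBy q (+ p) ⊎ RepBy q (+ (2 * p)))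
lemma2 =
    (λ a b c p T prim pp p∣c → reduced-det2⇒RepBy (prime-divisor⇒reducedForm 1 a b c T prim pp p∣c))
  , (λ a b c p T prim pp p∣c → reduced-det3⇒RepBy pp (prime-divisor⇒reducedForm 2 a b c T prim pp p∣c))
  , det5or6
  where
  det5or6 : (q : ℕ) → q ≡ 5 ⊎ q ≡ 6 → (a b : ℤ) (c p : ℕ) → InT q a b c → Primitive a b c →
            Prime p → p ∣ c → RepBy q (+ p) ⊎ RepBy q (+ (2 * p))
  det5or6 q q≡5⊎6 a b c p T prim pp p∣c = Sum.map₂ (subst (RepBy q) (sym (ℤ.pos-* 2 p))) (go q≡5⊎6)
    where
    go : q ≡ 5 ⊎ q ≡ 6 → RepBy q (+ p) ⊎ RepBy q (+ 2 · + p)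
    go (inj₁ refl) =
      reduced-det≤6⇒RepBy (from-yes (5 ℕ.≤? 6)) (prime-divisor⇒reducedForm 4 a b c T prim pp p∣c)
    go (inj₂ refl) =
      reduced-det≤6⇒RepBy (from-yes (6 ℕ.≤? 6)) (prime-divisor⇒reducedForm 5 a b c T prim pp p∣c)
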